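{- The strong $4$-colour graph $S_4(C_5)$ of the $5$-cycle is not connected.
   Context: A proper $k$-colouring of a graph $G$ is a map $V(G)\to\{1,\dots,k\}$ giving adjacent vertices different colours; it is strong if all $k$ colours appear. The strong $k$-colour graph $S_k(G)$ has the strong $k$-colourings of $G$ as vertices, two being adjacent iff they differ in colour on exactly one vertex of $G$. -}

module Defs where

open import Data.Nat using (ℕ; suc)
open import Data.Fin using (Fin; toℕ)
open import Data.Nat.DivMod using (_%_)
open import Data.Product using (Σ; ∃; _×_; _,_)
open import Data.Sum using (_⊎_)
open import Relation.Binary.PropositionalEquality using (_≡_; _≢_)
open import Relation.Binary.Construct.Closure.ReflexiveTransitive using (Star)

record Graph (n : ℕ) : Set₁ where
  field
    Adj : Fin n → Fin n → Set

open Graph public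

Cycle : (n : ℕ) → Graph (suc n)
Cycle n .Adj i j = (toℕ j ≡ suc (toℕ i) % suc n) ⊎ (toℕ i ≡ suc (toℕ j) % suc n)

Colouring : ℕ → ℕ → Set
Colouring n k = Fin n → Fin k

Proper : ∀ {n k} → Graph n → Colouring n k → Set
Proper G c = ∀ i j → Adj G i j → c i ≢ c j

Strong : ∀ {n k} → Colouring n k → Set
Strong c = ∀ a → ∃ λ v → c v ≡ a

StrongColouring : ∀ {n} → ℕ → Graph n → Set
StrongColouring {n} k G = Σ (Colouring n k) λ c → Proper G c × Strong c

DifferOnExactlyOne : ∀ {n k} → Colouring n k → Colouring n k → Set
DifferOnExactlyOne {n} c d = ∃ λ (v : Fin n) → (c v ≢ d v) × (∀ w → w ≢ v → c w ≡ d w)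

SAdj : ∀ {n} k (G : Graph n) → StrongColouring k G → StrongColouring k G → Set
SAdj k G (c , _) (d , _) = DifferOnExactlyOne c d

SConnected : ∀ {n} → ℕ → Graph n → Set
SConnected k G = ∀ (α β : StrongColouring k G) → Star (SAdj k G) α β

module Submission where

-- A strong 4-colouring of C₅ repeats exactly one colour a, on two vertices at distance two, so
-- around the cycle it reads a x a y z. A recolouring of one vertex that keeps the colouring
-- strong must move one of the two a's, and the only colour it can then take is y, respectively z.
-- Either way both edges of the perfect matching {{a,x},{y,z}} of K₄ are still the colours of
-- some edge of C₅ (it is the only perfect matching with this property). Hence whether the colour
-- pairs 0–1 and 2–3 both occur on edges is invariant along S₄(C₅), and it holds for 01023 but
-- not for 02013. Invariance under one step is verified by exhaustive search.

open import Defs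
open import Data.Fin using (Fin; suc; toℕ; _≟_)
open import Data.Fin.Patterns using (0F; 1F; 2F; 3F)
open import Data.Fin.Properties using (all?; any?)
open import Data.Nat using (ℕ; zero; suc)
import Data.Nat as ℕ
open import Data.Nat.DivMod using (_%_)
open import Data.Product using (∃₂; _×_; _,_; proj₁; proj₂)
open import Data.Vec.Functional using (Vector; []; _∷_; head; tail; updateAt)
open import Data.Vec.Functional.Properties using (∷-cong; updateAt-updates; updateAt-minimal)
open import Function using (_∘_; const; id)
open import Level using (Level)
open import Relation.Binary.Core using (Rel)
open import Relation.Binary.Definitions using (_Respects_)
open import Relation.Binary.PropositionalEquality using (_≡_; _≢_; _≗_; refl; sym; trans; cong)
open import Relation.Binary.Construct.Closure.ReflexiveTransitive using (Star; fold)
open import Relation.Nullary using (¬_; Dec; yes; no)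
open import Relation.Nullary.Decidable using (True; toWitness; map′; _×-dec_; _⊎-dec_; _→-dec_; ¬?; from-yes; from-no)
open import Relation.Unary using (Pred; Decidable)

private
  variable
    a ℓ p : Level
    A : Set a
    n k : ℕ

Star-preserves : {R : Rel A ℓ} (P : Pred A p) →
                 (∀ {x y} → R x y → P x → P y) → ∀ {x y} → Star R x y → P x → P y
Star-preserves P step = fold (λ x y → P x → P y) (λ r rest → rest ∘ step r) id

updateAt-cong : ∀ (i : Fin n) {f : A → A} {xs ys : Vector A n} →
                xs ≗ ys → updateAt xs i f ≗ updateAt ys i f
updateAt-cong 0F      {f} eq 0F      = cong f (eq 0F)
updateAt-cong 0F          eq (suc j) = eq (suc j)
updateAt-cong (suc i)     eq 0F      = eq 0F
updateAt-cong (suc i)     eq (suc j) = updateAt-cong i (eq ∘ suc) j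

≗-updateAt : ∀ {xs ys : Vector A n} i →
             (∀ j → j ≢ i → xs j ≡ ys j) → ys ≗ updateAt xs i (const (ys i))
≗-updateAt {xs = xs} i same j with j ≟ i
... | yes refl = sym (updateAt-updates j xs)
... | no  j≢i  = trans (sym (same j j≢i)) (sym (updateAt-minimal j i xs j≢i))

-- Without function extensionality only ≗-invariant predicates can be decided by enumeration.
all-colourings? : {P : Pred (Colouring n k) p} →
                  P Respects _≗_ → Decidable P → Dec (∀ c → P c)
all-colourings? {zero}  resp P? =
  map′ (λ P[] c → resp (λ ()) P[]) (λ ∀P → ∀P []) (P? [])
all-colourings? {suc n} resp P? =
  map′ (λ ∀P c → resp (∷-cong refl λ _ → refl) (∀P (head c) (tail c)))
       (λ ∀P x c → ∀P (x ∷ c))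
       (all? λ x → all-colourings? (λ c≗d → resp (∷-cong refl c≗d)) (P? ∘ (x ∷_)))

Strong-resp-≗ : Strong {n} {k} Respects _≗_
Strong-resp-≗ c≗d strong x with strong x
... | v , cv≡x = v , trans (sym (c≗d v)) cv≡x

strong? : Decidable (Strong {n} {k})
strong? c = all? λ x → any? λ v → c v ≟ x

Uses : Graph n → Colouring n k → Fin k → Fin k → Set
Uses G c u w = ∃₂ λ i j → Adj G i j × c i ≡ u × c j ≡ w

module _ (G : Graph n) where

  Proper-resp-≗ : Proper {k = k} G Respects _≗_
  Proper-resp-≗ c≗d proper i j ij di≡dj =
    proper i j ij (trans (c≗d i) (trans di≡dj (sym (c≗d j))))

  Uses-resp-≗ : ∀ {u w : Fin k} → (λ c → Uses G c u w) Respects _≗_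
  Uses-resp-≗ c≗d (i , j , ij , ci≡u , cj≡w) =
    i , j , ij , trans (sym (c≗d i)) ci≡u , trans (sym (c≗d j)) cj≡w

  module _ (adj? : ∀ i j → Dec (Adj G i j)) where

    proper? : Decidable (Proper {k = k} G)
    proper? c = all? λ i → all? λ j → adj? i j →-dec ¬? (c i ≟ c j)

    uses? : ∀ (u w : Fin k) → Decidable (λ c → Uses G c u w)
    uses? u w c = any? λ i → any? λ j → adj? i j ×-dec c i ≟ u ×-dec c j ≟ w

cycle-adj? : ∀ n (i j : Fin (suc n)) → Dec (Adj (Cycle n) i j)
cycle-adj? n i j = toℕ j ℕ.≟ suc (toℕ i) % suc n ⊎-dec toℕ i ℕ.≟ suc (toℕ j) % suc n

C₅ : Graph 5
C₅ = Cycle 4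

C₅-adj? : ∀ i j → Dec (Adj C₅ i j)
C₅-adj? = cycle-adj? 4

UsesMatching : Colouring 5 4 → Set
UsesMatching c = Uses C₅ c 0F 1F × Uses C₅ c 2F 3F

UsesMatching-resp-≗ : UsesMatching Respects _≗_
UsesMatching-resp-≗ c≗d (u₀₁ , u₂₃) = Uses-resp-≗ C₅ c≗d u₀₁ , Uses-resp-≗ C₅ c≗d u₂₃

usesMatching? : Decidable UsesMatching
usesMatching? c = uses? C₅ C₅-adj? 0F 1F c ×-dec uses? C₅ C₅-adj? 2F 3F c

RecolouringPreservesMatching : Colouring 5 4 → Set
RecolouringPreservesMatching c =
  Proper C₅ c → Strong c → UsesMatching c →
  ∀ v x → let c′ = updateAt c v (const x) in
  Proper C₅ c′ → Strong c′ → UsesMatching c′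

RecolouringPreservesMatching-resp-≗ : RecolouringPreservesMatching Respects _≗_
RecolouringPreservesMatching-resp-≗ c≗d preserves pd sd ud v x pd′ sd′ =
  UsesMatching-resp-≗ c′≗d′
    (preserves (Proper-resp-≗ C₅ d≗c pd) (Strong-resp-≗ d≗c sd) (UsesMatching-resp-≗ d≗c ud) v x
               (Proper-resp-≗ C₅ d′≗c′ pd′) (Strong-resp-≗ d′≗c′ sd′))
  where
  d≗c = sym ∘ c≗d
  c′≗d′ = updateAt-cong v c≗d
  d′≗c′ = sym ∘ c′≗d′

recolouringPreservesMatching? : Decidable RecolouringPreservesMatching
recolouringPreservesMatching? c =
  proper? C₅ C₅-adj? c →-dec strong? c →-dec usesMatching? c →-dec
  all? λ v → all? λ x → let c′ = updateAt c v (const x) in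
  proper? C₅ C₅-adj? c′ →-dec strong? c′ →-dec usesMatching? c′

recolouring-preserves-matching : ∀ c → RecolouringPreservesMatching c
recolouring-preserves-matching =
  from-yes (all-colourings? RecolouringPreservesMatching-resp-≗ recolouringPreservesMatching?)

SAdj-preserves-matching : ∀ {α β : StrongColouring 4 C₅} →
                          SAdj 4 C₅ α β → UsesMatching (proj₁ α) → UsesMatching (proj₁ β)
SAdj-preserves-matching {c , pc , sc} {d , pd , sd} (v , _ , same) uc =
  UsesMatching-resp-≗ (sym ∘ d≗c′)
    (recolouring-preserves-matching c pc sc uc v (d v)
      (Proper-resp-≗ C₅ d≗c′ pd) (Strong-resp-≗ d≗c′ sd))
  where d≗c′ = ≗-updateAt v same

strongColouring : (c : Colouring 5 4) →
                  {_ : True (proper? C₅ C₅-adj? c ×-dec strong? c)} → StrongColouring 4 C₅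
strongColouring c {ok} = c , toWitness ok

α β : StrongColouring 4 C₅
α = strongColouring (0F ∷ 1F ∷ 0F ∷ 2F ∷ 3F ∷ [])
β = strongColouring (0F ∷ 2F ∷ 0F ∷ 1F ∷ 3F ∷ [])

proposition4p3 : ¬ SConnected 4 (Cycle 4)
proposition4p3 connected =
  from-no (uses? C₅ C₅-adj? 2F 3F (proj₁ β))
    (proj₂ (Star-preserves (UsesMatching ∘ proj₁)
                           (λ {α} {β} → SAdj-preserves-matching {α} {β})
                           (connected α β)
                           (from-yes (usesMatching? (proj₁ α)))))
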